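{- Let $f:\{0,1\}^n\to\{0,1\}^n$ be a Boolean network whose interaction graph has no positive cycles, and let $x\in\{0,1\}^n$ be any state. Then $f$ has a fixed point if and only if $f^{\langle n\rangle}(x)=f^{\langle n+1\rangle}(x)$, in which case $f^{\langle n\rangle}(x)$ is a fixed point of $f$. In particular, whether $f$ has a fixed point can be determined through $n+1$ applications of $f$ starting from any state.
   Context: A Boolean network with $n$ components is a map $f=(f_1,\dots,f_n):\{0,1\}^n\to\{0,1\}^n$; a fixed point is $x$ with $f(x)=x$. With $e_u$ the $u$-th unit vector, the interaction graph $G(f)$ is the signed digraph on $[n]$ with a positive arc $(u,v)$ if some $x$ with $x_u=0$ has $f_v(x)<f_v(x+e_u)$, and a negative arc $(u,v)$ if some $x$ with $x_u=0$ has $f_v(x)>f_v(x+e_u)$. A cycle is a closed directed path; it is positive if the product of its arc signs is $+1$. $f^{\langle 0\rangle}$ is the identity and $f^{\langle k\rangle}=f\circ f^{\langle k-1\rangle}$. -}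

module Defs where

open import Data.Nat as ℕ using (ℕ; zero; suc)
open import Data.Nat.Properties using () renaming (_<?_ to _<ℕ?_)
open import Data.Bool using (Bool; true; false; not; _xor_)
open import Data.Fin using (Fin; zero; suc; toℕ; fromℕ<)
open import Data.Vec using (Vec; lookup; _[_]≔_)
open import Data.Product using (Σ; ∃; _×_; _,_)
open import Relation.Binary.PropositionalEquality using (_≡_)
open import Relation.Nullary using (¬_; yes; no)
open import Function.Definitions using (Injective)

-- states of {0,1}^n : Boolean vectors (false = 0, true = 1)
State : ℕ → Set
State n = Vec Bool n

BN : ℕ → Set
BN n = State n → State n

-- x + e_u (used only when x_u = 0): set component u to 1
_+e_ : ∀ {n} → State n → Fin n → State n
x +e u = x [ u ]≔ true

data Sign : Set where
  pos neg : Sign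

Arc : ∀ {n} → BN n → Sign → Fin n → Fin n → Set
Arc {n} f pos u v = Σ (State n) λ x →
  lookup x u ≡ false × lookup (f x) v ≡ false × lookup (f (x +e u)) v ≡ true
Arc {n} f neg u v = Σ (State n) λ x →
  lookup x u ≡ false × lookup (f x) v ≡ true × lookup (f (x +e u)) v ≡ false

next : ∀ {k} → Fin (suc k) → Fin (suc k)
next {k} i with suc (toℕ i) <ℕ? suc k
... | yes p = fromℕ< p
... | no _  = zero

negParity : ∀ {k} → (Fin k → Sign) → Bool
negParity {zero}  s = false
negParity {suc k} s = isNeg (s zero) xor negParity (λ i → s (suc i))
  where
  isNeg : Sign → Bool
  isNeg pos = false
  isNeg neg = true

-- a cycle of G(f) of length suc k: pairwise distinct vertices vs 0, …, vs k,
-- with an arc of sign sg i from vs i to vs (i+1 mod (k+1))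
record Cycle {n} (f : BN n) (k : ℕ) : Set where
  field
    vs     : Fin (suc k) → Fin n
    sg     : Fin (suc k) → Sign
    distinct : Injective _≡_ _≡_ vs
    arcs   : ∀ i → Arc f (sg i) (vs i) (vs (next i))

-- positive cycle: the product of its arc signs is +1 (even number of negative arcs)
PositiveCycle : ∀ {n} {f : BN n} {k} → Cycle f k → Set
PositiveCycle c = negParity (Cycle.sg c) ≡ false

NoPositiveCycle : ∀ {n} → BN n → Set
NoPositiveCycle f = ∀ k (c : Cycle f k) → ¬ PositiveCycle c

iter : ∀ {n} → BN n → ℕ → State n → State n
iter f zero    x = x
iter f (suc k) x = f (iter f k x)

IsFixedPoint : ∀ {n} → BN n → State n → Set
IsFixedPoint f x = f x ≡ x

HasFixedPoint : ∀ {n} → BN n → Set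
HasFixedPoint {n} f = ∃ λ (x : State n) → IsFixedPoint f x

-- Let y be a fixed point. If f⁽ᵗ⁺¹⁾(x) differs from y at i, then moving from y to
-- f⁽ᵗ⁾(x) one coordinate at a time changes f_i at some coordinate j where f⁽ᵗ⁾(x)
-- also differs from y; this yields an arc j → i which is positive iff y_j = y_i.
-- Iterating n times gives a walk of n + 1 vertices in [n] along such arcs, hence
-- a cycle along such arcs, and the number of sign changes of y around a cycle is
-- even: the cycle is positive. So without positive cycles f⁽ⁿ⁾(x) = y for every x.
module Submission where

open import Defs
open import Data.Nat using (ℕ; zero; suc; _+_; _∸_; _≤_; _<_; z≤n; s≤s; s<s; s≤s⁻¹)
open import Data.Nat.Properties
  using (_<?_; _≤?_; <⇒≤; ≤-refl; ≤-reflexive; ≤-trans; ≤-antisym; ≮⇒≥; <-irrefl; n<1+n;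
         m≤n⇒m≤1+n; m≤n⇒m<n∨m≡n; +-suc; +-identityʳ; +-monoʳ-≤; +-cancelˡ-≡; m+[n∸m]≡n)
open import Data.Bool using (Bool; true; false; not; _xor_)
open import Data.Bool.Properties using (not-involutive; ¬-not; xor-same) renaming (_≟_ to _≟ᵇ_)
open import Data.Fin using (Fin; zero; suc; toℕ; fromℕ<)
open import Data.Fin.Properties using (toℕ-injective; toℕ-fromℕ<; toℕ≤pred[n]; any?; pigeonhole)
  renaming (_≟_ to _≟ᶠ_)
open import Data.Vec using (Vec; []; _∷_; lookup; _[_]≔_)
open import Data.Vec.Properties using (tabulate∘lookup; tabulate-cong; lookup∘update; []≔-idempotent)
open import Data.Product using (Σ; ∃; ∃₂; _×_; _,_)
open import Data.Sum using (_⊎_; inj₁; inj₂)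
open import Function using (_∘_)
open import Function.Bundles using (_⇔_; mk⇔)
open import Relation.Nullary using (¬_; yes; no; contradiction)
open import Relation.Nullary.Decidable using (decidable-stable)
open import Relation.Binary.Definitions using (DecidableEquality)
open import Relation.Binary.PropositionalEquality
  using (_≡_; _≢_; refl; sym; trans; cong; subst; subst₂)

lookup-extensionality : ∀ {A : Set} {n} {xs ys : Vec A n} →
  (∀ i → lookup xs i ≡ lookup ys i) → xs ≡ ys
lookup-extensionality {xs = xs} {ys} same =
  trans (sym (tabulate∘lookup xs)) (trans (tabulate-cong same) (tabulate∘lookup ys))

agree : Bool → Bool → Sign
agree false false = pos
agree true  true  = pos
agree false true  = neg
agree true  false = neg

negParity-telescope : ∀ k (Z : ℕ → Bool) →
  negParity {k} (λ i → agree (Z (toℕ i)) (Z (suc (toℕ i)))) ≡ Z 0 xor Z k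
negParity-telescope zero    Z = sym (xor-same (Z 0))
negParity-telescope (suc k) Z rewrite negParity-telescope k (λ m → Z (suc m)) with Z 0 | Z 1
... | false | false = refl
... | false | true  = not-involutive (Z (suc k))
... | true  | false = refl
... | true  | true  = refl

toℕ-next : ∀ {k} (i : Fin (suc k)) → toℕ (next i) ≡ suc (toℕ i) ⊎ (next i ≡ zero × toℕ i ≡ k)
toℕ-next {k} i with suc (toℕ i) <? suc k
... | yes lt = inj₁ (toℕ-fromℕ< lt)
... | no ¬lt = inj₂ (refl , ≤-antisym (toℕ≤pred[n] i) (≮⇒≥ (¬lt ∘ s<s)))

InjectiveUpTo : ∀ {A : Set} → (ℕ → A) → ℕ → Set
InjectiveUpTo w b = ∀ {p q} → p ≤ b → q ≤ b → w p ≡ w q → p ≡ q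

SimpleLoop : ∀ {A : Set} → (ℕ → A) → ℕ → Set
SimpleLoop v k = v 0 ≡ v (suc k) × InjectiveUpTo v k

simpleLoop-next : ∀ {A : Set} {v : ℕ → A} {k} → SimpleLoop v k →
  (i : Fin (suc k)) → v (toℕ (next i)) ≡ v (suc (toℕ i))
simpleLoop-next {v = v} (closed , _) i with toℕ-next i
... | inj₁ step         = cong v step
... | inj₂ (wrap , last) = trans (cong (v ∘ toℕ) wrap) (trans closed (cong (v ∘ suc) (sym last)))

simpleLoop-distinct : ∀ {A : Set} {v : ℕ → A} {k} → SimpleLoop v k →
  ∀ {i j : Fin (suc k)} → v (toℕ i) ≡ v (toℕ j) → i ≡ j
simpleLoop-distinct (_ , injective) {i} {j} same =
  toℕ-injective (injective (toℕ≤pred[n] i) (toℕ≤pred[n] j) same)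

injectiveUpTo-suc : ∀ {A : Set} {w : ℕ → A} {b} → InjectiveUpTo w b →
  (∀ {a} → a ≤ b → w a ≢ w (suc b)) → InjectiveUpTo w (suc b)
injectiveUpTo-suc injective fresh p≤ q≤ same with m≤n⇒m<n∨m≡n p≤ | m≤n⇒m<n∨m≡n q≤
... | inj₁ p<   | inj₁ q<   = injective (s≤s⁻¹ p<) (s≤s⁻¹ q<) same
... | inj₁ p<   | inj₂ refl = contradiction same (fresh (s≤s⁻¹ p<))
... | inj₂ refl | inj₁ q<   = contradiction (sym same) (fresh (s≤s⁻¹ q<))
... | inj₂ refl | inj₂ refl = refl

injective-or-repeat : ∀ {A : Set} → DecidableEquality A → (w : ℕ → A) (b : ℕ) → InjectiveUpTo w b ⊎
  ∃₂ λ a k → a + suc k ≤ b × w a ≡ w (a + suc k) × InjectiveUpTo w (a + k)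
injective-or-repeat _≟_ w zero = inj₁ λ { z≤n z≤n _ → refl }
injective-or-repeat _≟_ w (suc b) with injective-or-repeat _≟_ w b
... | inj₂ (a , k , within , repeat , injective) =
      inj₂ (a , k , m≤n⇒m≤1+n within , repeat , injective)
... | inj₁ injective with any? (λ (a : Fin (suc b)) → w (toℕ a) ≟ w (suc b))
...   | yes (a , repeat) =
        inj₂ (toℕ a , b ∸ toℕ a , ≤-reflexive ends , trans repeat (cong w (sym ends)) ,
              subst (InjectiveUpTo w) (sym (m+[n∸m]≡n (toℕ≤pred[n] a))) injective)
  where
  ends : toℕ a + suc (b ∸ toℕ a) ≡ suc b
  ends = trans (+-suc (toℕ a) _) (cong suc (m+[n∸m]≡n (toℕ≤pred[n] a)))
...   | no noRepeat = inj₁ (injectiveUpTo-suc injective fresh)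
  where
  fresh : ∀ {a} → a ≤ b → w a ≢ w (suc b)
  fresh a≤b repeat =
    noRepeat (fromℕ< (s≤s a≤b) , subst (λ c → w c ≡ w (suc b)) (sym (toℕ-fromℕ< (s≤s a≤b))) repeat)

first-repetition : ∀ {n} (w : ℕ → Fin n) →
  ∃₂ λ a k → a + suc k ≤ n × SimpleLoop (λ m → w (a + m)) k
first-repetition {n} w with injective-or-repeat _≟ᶠ_ w n
... | inj₁ injective with pigeonhole (n<1+n n) (w ∘ toℕ)
...   | i , j , i<j , same =
        contradiction (injective (toℕ≤pred[n] i) (toℕ≤pred[n] j) same) (λ eq → <-irrefl eq i<j)
first-repetition w | inj₂ (a , k , within , repeat , injective) =
  a , k , within , trans (cong w (+-identityʳ a)) repeat , shifted
  where
  shifted : InjectiveUpTo (λ m → w (a + m)) k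
  shifted p≤ q≤ same = +-cancelˡ-≡ a _ _ (injective (+-monoʳ-≤ a p≤) (+-monoʳ-≤ a q≤) same)

module _ {V : Set} where

  extendAfter : (ℕ → V) → ℕ → V → ℕ → V
  extendAfter w t i m with m ≤? t
  ... | yes _ = w m
  ... | no  _ = i

  extendAfter-≤ : ∀ w {t} i {m} → m ≤ t → extendAfter w t i m ≡ w m
  extendAfter-≤ w {t} i {m} m≤t with m ≤? t
  ... | yes _   = refl
  ... | no m≰t = contradiction m≤t m≰t

  extendAfter-suc : ∀ w t i → extendAfter w t i (suc t) ≡ i
  extendAfter-suc w t i with suc t ≤? t
  ... | yes t<t = contradiction t<t (<-irrefl refl)
  ... | no  _   = refl

  walk-back : (P : ℕ → V → Set) (R : V → V → Set) →
    (∀ {t i} → P (suc t) i → ∃ λ j → P t j × R j i) →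
    ∀ t {i} → P t i → Σ (ℕ → V) λ w → w t ≡ i × (∀ m → m < t → R (w m) (w (suc m)))
  walk-back P R back zero {i} _ = (λ _ → i) , refl , λ _ ()
  walk-back P R back (suc t) {i} pi with back pi
  ... | j , pj , rji with walk-back P R back t pj
  ...   | w , wt , steps = extendAfter w t i , extendAfter-suc w t i , steps′
    where
    steps′ : ∀ m → m < suc t → R (extendAfter w t i m) (extendAfter w t i (suc m))
    steps′ m m<1+t with m≤n⇒m<n∨m≡n (s≤s⁻¹ m<1+t)
    ... | inj₁ m<t  = subst₂ R (sym (extendAfter-≤ w i (<⇒≤ m<t)))
                               (sym (extendAfter-≤ w i m<t)) (steps m m<t)
    ... | inj₂ refl = subst₂ R (sym (trans (extendAfter-≤ w i ≤-refl) wt))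
                               (sym (extendAfter-suc w t i)) rji

coordinate-flip : ∀ {A B : Set} → DecidableEquality B → ∀ {n} (g : Vec A n → B) (y z : Vec A n) →
  g z ≢ g y → ∃₂ λ w j → g (w [ j ]≔ lookup y j) ≡ g y × g (w [ j ]≔ lookup z j) ≢ g y
coordinate-flip _≟_ g []      []      differ = contradiction refl differ
coordinate-flip _≟_ g (a ∷ y) (c ∷ z) differ with g (c ∷ y) ≟ g (a ∷ y)
... | no flips  = a ∷ y , zero , refl , flips
... | yes same with coordinate-flip _≟_ (g ∘ (c ∷_)) y z (λ eq → differ (trans eq same))
...   | w , j , unflipped , flipped =
        c ∷ w , suc j , trans unflipped same , λ eq → flipped (trans eq (sym same))

flip⇒arc : ∀ {n} (f : BN n) (x : State n) (u v : Fin n) (a b : Bool) →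
  lookup (f (x [ u ]≔ a)) v ≡ b → lookup (f (x [ u ]≔ not a)) v ≡ not b → Arc f (agree a b) u v
flip⇒arc f x u v = witness
  where
  raise : ∀ {c} → lookup (f (x [ u ]≔ true)) v ≡ c → lookup (f ((x [ u ]≔ false) +e u)) v ≡ c
  raise = subst (λ s → lookup (f s) v ≡ _) (sym ([]≔-idempotent x u))

  witness : ∀ a b → lookup (f (x [ u ]≔ a)) v ≡ b → lookup (f (x [ u ]≔ not a)) v ≡ not b →
            Arc f (agree a b) u v
  witness false false low high = x [ u ]≔ false , lookup∘update u x false , low , raise high
  witness false true  low high = x [ u ]≔ false , lookup∘update u x false , low , raise high
  witness true  false low high = x [ u ]≔ false , lookup∘update u x false , high , raise low
  witness true  true  low high = x [ u ]≔ false , lookup∘update u x false , high , raise low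

ConsistentArc : ∀ {n} → BN n → State n → Fin n → Fin n → Set
ConsistentArc f y u v = Arc f (agree (lookup y u) (lookup y v)) u v

module _ {n} (f : BN n) (y : State n) where

  consistent-loop⇒positive-cycle : ∀ {v : ℕ → Fin n} {k} → SimpleLoop v k →
    (∀ m → m ≤ k → ConsistentArc f y (v m) (v (suc m))) → Σ (Cycle f k) PositiveCycle
  consistent-loop⇒positive-cycle {v} {k} loop@(closed , _) steps = cycle , positive
    where
    Z : ℕ → Bool
    Z = lookup y ∘ v

    cycle : Cycle f k
    cycle = record
      { vs       = v ∘ toℕ
      ; sg       = λ i → agree (Z (toℕ i)) (Z (suc (toℕ i)))
      ; distinct = simpleLoop-distinct loop
      ; arcs     = λ i → subst (Arc f (agree (Z (toℕ i)) (Z (suc (toℕ i)))) (v (toℕ i)))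
                               (sym (simpleLoop-next loop i)) (steps (toℕ i) (toℕ≤pred[n] i))
      }

    positive : PositiveCycle cycle
    positive = trans (negParity-telescope (suc k) Z)
                     (subst (λ b → Z 0 xor b ≡ false) (cong (lookup y) closed) (xor-same (Z 0)))

  consistent-walk⇒positive-cycle : (w : ℕ → Fin n) →
    (∀ m → m < n → ConsistentArc f y (w m) (w (suc m))) → ∃ λ k → Σ (Cycle f k) PositiveCycle
  consistent-walk⇒positive-cycle w steps with first-repetition w
  ... | a , k , within , loop = k , consistent-loop⇒positive-cycle loop shifted
    where
    shifted : ∀ m → m ≤ k → ConsistentArc f y (w (a + m)) (w (a + suc m))
    shifted m m≤k = subst (λ c → ConsistentArc f y (w (a + m)) (w c)) (sym (+-suc a m))
      (steps (a + m) (≤-trans (s≤s (+-monoʳ-≤ a m≤k)) (≤-trans (≤-reflexive (sym (+-suc a k))) within)))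

module _ {n} (f : BN n) (y : State n) (fixed : IsFixedPoint f y) where

  fixed-at : ∀ i → lookup (f y) i ≡ lookup y i
  fixed-at i = cong (λ s → lookup s i) fixed

  deviation-source : (z : State n) (i : Fin n) → lookup (f z) i ≢ lookup y i →
    ∃ λ j → lookup z j ≢ lookup y j × ConsistentArc f y j i
  deviation-source z i deviates
    with coordinate-flip _≟ᵇ_ (λ s → lookup (f s) i) y z (λ eq → deviates (trans eq (fixed-at i)))
  ... | w , j , unflipped , flipped =
    j , differs , flip⇒arc f w j i (lookup y j) (lookup y i) (trans unflipped (fixed-at i)) (¬-not flipped′)
    where
    differs : lookup z j ≢ lookup y j
    differs same = flipped (trans (cong (λ c → lookup (f (w [ j ]≔ c)) i) same) unflipped)

    flipped′ : lookup (f (w [ j ]≔ not (lookup y j))) i ≢ lookup y i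
    flipped′ = subst (λ c → lookup (f (w [ j ]≔ c)) i ≢ lookup y i) (¬-not differs)
                     (λ eq → flipped (trans eq (sym (fixed-at i))))

  no-positive-cycle⇒iter-reaches : NoPositiveCycle f → ∀ x → iter f n x ≡ y
  no-positive-cycle⇒iter-reaches npc x =
    lookup-extensionality λ i → decidable-stable (lookup (iter f n x) i ≟ᵇ lookup y i) (no-deviation i)
    where
    Deviates : ℕ → Fin n → Set
    Deviates t i = lookup (iter f t x) i ≢ lookup y i

    no-deviation : ∀ i → ¬ Deviates n i
    no-deviation i deviates
      with walk-back Deviates (ConsistentArc f y) (λ {t} {i} → deviation-source (iter f t x) i) n deviates
    ... | w , _ , steps with consistent-walk⇒positive-cycle f y w steps
    ...   | k , cycle , positive = npc k cycle positive

corollary1 : (n : ℕ) (f : BN n) → NoPositiveCycle f → (x : State n) →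
    (HasFixedPoint f ⇔ (iter f n x ≡ iter f (suc n) x))
    × (iter f n x ≡ iter f (suc n) x → IsFixedPoint f (iter f n x))
corollary1 n f npc x = mk⇔ stabilises fixedPointOf , sym
  where
  stabilises : HasFixedPoint f → iter f n x ≡ iter f (suc n) x
  stabilises (y , fixed) = trans reaches (sym (trans (cong f reaches) fixed))
    where
    reaches : iter f n x ≡ y
    reaches = no-positive-cycle⇒iter-reaches f y fixed npc x

  fixedPointOf : iter f n x ≡ iter f (suc n) x → HasFixedPoint f
  fixedPointOf stable = iter f n x , sym stable
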